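{- There exists a context-free language over $\{0,1\}$ that is $\mathrm{REG}/n$-primeimmune but not weak $\mathrm{REG}/n$-pseudorandom.
   Context: Let $\Sigma=\{0,1\}$. A function $\mu:\mathbb{N}\to\mathbb{R}_{\ge0}$ is negligible if for every non-zero polynomial $p$, $\mu(n)\le1/p(n)$ for all sufficiently large $n$. $A$ is p-dense if there exist $n_0$ and a non-zero polynomial $p$ with $|A\cap\Sigma^n|\ge|\Sigma^n|/p(n)$ for $n\ge n_0$. $L$ is $\mathrm{REG}/n$-primeimmune if $L$ is p-dense and has no p-dense subset in $\mathrm{REG}/n$. $L$ is weak $\mathrm{REG}/n$-pseudorandom if for every p-dense $A\in\mathrm{REG}/n$ the function $n\mapsto\left|\frac{|L\cap A\cap\Sigma^n|}{|A\cap\Sigma^n|}-\frac12\right|$ is negligible. $\mathrm{REG}/n$ is the family of languages $L$ over $\Sigma$ for which there exist an alphabet $\Gamma$, $h:\mathbb{N}\to\Gamma^*$ with $|h(n)|=n$, and a regular language $A$ over $\Sigma\times\Gamma$ with $x\in L$ iff $\left[\begin{smallmatrix}x\\ h(|x|)\end{smallmatrix}\right]\in A$ for all $x$, where $\left[\begin{smallmatrix}x_1\cdots x_n\\ y_1\cdots y_n\end{smallmatrix}\right]=(x_1,y_1)\cdots(x_n,y_n)$. -}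

module Defs where

open import Data.Bool using (Bool; T; true; false; T?; _∧_)
open import Data.Nat as ℕ using (ℕ; zero; suc; _≥_; _^_)
open import Data.Fin using (Fin)
open import Data.List using (List; []; _∷_; _++_; length; filter; map; concatMap; zip)
open import Data.List.Relation.Unary.Any using (Any)
open import Data.List.Membership.Propositional using (_∈_)
open import Data.Vec using (Vec; toList)
open import Data.Product using (Σ; _×_; _,_; ∃; ∃-syntax)
open import Data.Sum using (_⊎_; inj₁; inj₂)
open import Data.Integer using (+_)
open import Data.Rational as ℚ using (ℚ; 0ℚ; ½; ∣_∣; _-_)
open import Relation.Nullary using (¬_)
open import Relation.Binary.PropositionalEquality using (_≡_; _≢_)
open import Function.Bundles using (_⇔_)

-- Alphabet Σ = {0,1} is Bool; words are List Bool.
-- A language over Σ is given by its (Boolean) characteristic function.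
Language : Set
Language = List Bool → Bool

words : ℕ → List (List Bool)
words zero    = [] ∷ []
words (suc n) = concatMap (λ w → (false ∷ w) ∷ (true ∷ w) ∷ []) (words n)

count : Language → ℕ → ℕ
count L n = length (filter (λ w → T? (L w)) (words n))

_∩_ : Language → Language → Language
(L ∩ A) w = L w ∧ A w

_⊆_ : Language → Language → Set
A ⊆ L = ∀ x → T (A x) → T (L x)

-- Polynomials with natural-number coefficients (coefficient lists,
-- constant term first); "non-zero" = some coefficient is non-zero.

Poly : Set
Poly = List ℕ

eval : Poly → ℕ → ℕ
eval []       n = 0
eval (c ∷ cs) n = c ℕ.+ n ℕ.* eval cs n

NonZeroPoly : Poly → Set
NonZeroPoly p = Any (λ c → c ≢ 0) p

toℚ : ℕ → ℚ
toℚ n = (+ n) ℚ./ 1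

-- μ negligible: for every non-zero polynomial p, μ(n) ≤ 1/p(n) for
-- all sufficiently large n  (written μ(n)·p(n) ≤ 1, p(n) > 0 for n ≥ 1).
Negligible : (ℕ → ℚ) → Set
Negligible μ = ∀ (p : Poly) → NonZeroPoly p →
  ∃[ n₀ ] ∀ n → n ≥ n₀ → μ n ℚ.* toℚ (eval p n) ℚ.≤ ℚ.1ℚ

-- A p-dense: ∃ n₀, non-zero p with |A ∩ Σ^n| ≥ 2^n / p(n) for n ≥ n₀
-- (written |A ∩ Σ^n| · p(n) ≥ 2^n).
PDense : Language → Set
PDense A = ∃[ n₀ ] Σ Poly λ p → NonZeroPoly p ×
  (∀ n → n ≥ n₀ → count A n ℕ.* eval p n ≥ 2 ^ n)

record DFA (Γ : Set) : Set where
  field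
    states : ℕ
    start  : Fin states
    δ      : Fin states → Γ → Fin states
    final  : Fin states → Bool

run : ∀ {Γ} (D : DFA Γ) → Fin (DFA.states D) → List Γ → Fin (DFA.states D)
run D q []       = q
run D q (a ∷ as) = run D (DFA.δ D q a) as

accepts : ∀ {Γ} → DFA Γ → List Γ → Bool
accepts D w = DFA.final D (run D (DFA.start D) w)

-- L ∈ REG/n: there exist a finite alphabet Γ (= Fin m), an advice
-- function h with |h(n)| = n, and a regular language over Σ × Γ
-- (given by a DFA) such that x ∈ L iff [x; h(|x|)] is accepted.
REG/n : Language → Set
REG/n L = Σ ℕ λ m → Σ ((n : ℕ) → Vec (Fin m) n) λ h →
  Σ (DFA (Bool × Fin m)) λ D →
    ∀ x → L x ≡ accepts D (zip x (toList (h (length x))))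

record CFG : Set where
  field
    nonterminals : ℕ
    rules : List (Fin nonterminals × List (Fin nonterminals ⊎ Bool))
    start : Fin nonterminals

module _ (G : CFG) where
  open CFG G
  Symbol : Set
  Symbol = Fin nonterminals ⊎ Bool

  mutual
    data Gen : Fin nonterminals → List Bool → Set where
      rule : ∀ {X rhs w} → (X , rhs) ∈ rules → GenSeq rhs w → Gen X w

    data GenSeq : List Symbol → List Bool → Set where
      []   : GenSeq [] []
      term : ∀ {b s w} → GenSeq s w → GenSeq (inj₂ b ∷ s) (b ∷ w)
      nt   : ∀ {X s u w} → Gen X u → GenSeq s w → GenSeq (inj₁ X ∷ s) (u ++ w)

CFL : Language → Set
CFL L = Σ CFG λ G → ∀ x → T (L x) ⇔ Gen G (CFG.start G) x

PrimeImmune : Language → Set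
PrimeImmune L = PDense L × ¬ (Σ Language λ A → REG/n A × A ⊆ L × PDense A)

-- |L∩A∩Σ^n| / |A∩Σ^n|, with the (irrelevant for p-dense A, for large n)
-- convention 0 when the denominator is 0.
ratio : ℕ → ℕ → ℚ
ratio c zero    = 0ℚ
ratio c (suc d) = (+ c) ℚ./ suc d

deviation : Language → Language → ℕ → ℚ
deviation L A n = ∣ ratio (count (L ∩ A) n) (count A n) - ½ ∣

WeakPseudorandom : Language → Set
WeakPseudorandom L = ∀ A → REG/n A → PDense A → Negligible (deviation L A)

-- The witness is the language of binary words of length n with exactly ⌈n/2⌉ ones.
-- It is generated by a grammar built from the balanced-word grammar, and it is p-dense
-- because the central binomial coefficient is at least 2ⁿ/(n+1).  It is not weakly
-- pseudorandom: with the parity of ⌈n/2⌉ as advice, a two-state automaton accepts exactly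
-- the words whose number of ones has the other parity, a set of density ½ disjoint from it.
-- It is primeimmune: if a k-state advice automaton accepts only words of the language, then
-- in every block of k letters two of the k+1 prefixes 1ʲ0ᵏ⁻ʲ reach the same state, and that
-- state accepts nothing, since any completion would give two accepted words of equal length
-- with different numbers of ones.  Hence at most (2ᵏ−1)ᵗ words of length kt are accepted,
-- which is eventually below 2ᵏᵗ/p(kt) for every polynomial p.

module Submission where

open import Defs
open import Data.Bool using (Bool; true; false; T; T?; not; if_then_else_; _xor_)
open import Data.Bool.Properties using (xor-assoc; xor-comm; xor-identityʳ; xor-same; not-distribˡ-xor)
open import Data.Empty using (⊥-elim)
open import Data.Fin using (Fin; toℕ) renaming (zero to #0; suc to #suc)
open import Data.Fin.Properties using (2↔Bool; pigeonhole; toℕ≤pred[n])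
open import Data.List using (List; []; _∷_; _++_; length; filter; concatMap; zip; foldr; map; replicate)
open import Data.List.Properties using (++-identityʳ; length-++; length-++-≤ˡ; length-++-≤ʳ; length-replicate)
open import Data.List.Relation.Unary.Any using (here; there)
open import Data.Nat
  using (ℕ; zero; suc; _+_; _*_; _∸_; _^_; _≤_; _<_; z≤n; s≤s; _≡ᵇ_; ⌈_/2⌉; NonZero; >-nonZero; >-nonZero⁻¹)
open import Data.Nat.Combinatorics using (_C_; nCk≡nC[n∸k]; nCn≡1; nC1≡n; nCk+nC[k+1]≡[n+1]C[k+1])
open import Data.Nat.Properties
open import Algebra.Properties.CommutativeSemigroup +-commutativeSemigroup using (interchange)
open import Data.Nat.Tactic.RingSolver using (solve-∀)
open import Data.Product using (Σ; _×_; _,_)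
import Data.Rational as ℚ
import Data.Rational.Properties as ℚ
open import Data.Sum using (_⊎_; inj₁; inj₂)
open import Data.Unit using (tt)
open import Data.Vec using (Vec; toList) renaming ([] to []ᵥ; _∷_ to _∷ᵥ_; replicate to replicateᵥ)
open import Data.Vec.Properties using (length-toList)
open import Function using (_∘_; _⇔_; mk⇔; Equivalence; Inverse)
open import Relation.Binary.PropositionalEquality
open import Relation.Nullary using (¬_)
open import Relation.Nullary.Decidable using (toWitnessFalse)

indicator : Bool → ℕ
indicator b = if b then 1 else 0

indicator-positive : ∀ {b} → 0 < indicator b → T b
indicator-positive {true} _ = _

indicator-not : ∀ b → indicator b + indicator (not b) ≡ 1
indicator-not true  = refl
indicator-not false = refl

indicator≤1 : ∀ b → indicator b ≤ 1
indicator≤1 true  = ≤-refl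
indicator≤1 false = z≤n

sumWords : ℕ → (List Bool → ℕ) → ℕ
sumWords zero    f = f []
sumWords (suc n) f = sumWords n (f ∘ (false ∷_)) + sumWords n (f ∘ (true ∷_))

count≡sumWords : ∀ L n → count L n ≡ sumWords n (indicator ∘ L)
count≡sumWords L zero with L []
... | true  = refl
... | false = refl
count≡sumWords L (suc n) = begin
  count L (suc n)                                   ≡⟨ filter-concatMap L (words n) ⟩
  count (L ∘ (false ∷_)) n + count (L ∘ (true ∷_)) n ≡⟨ cong₂ _+_ (count≡sumWords _ n) (count≡sumWords _ n) ⟩
  sumWords (suc n) (indicator ∘ L)                  ∎
  where
  open ≡-Reasoning
  hits : (List Bool → Bool) → List (List Bool) → ℕ
  hits P = length ∘ filter (T? ∘ P)
  hits-∷ : ∀ P w ws → hits P (w ∷ ws) ≡ indicator (P w) + hits P ws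
  hits-∷ P w ws with P w
  ... | true  = refl
  ... | false = refl
  filter-concatMap : ∀ P ws →
    hits P (concatMap (λ w → (false ∷ w) ∷ (true ∷ w) ∷ []) ws) ≡ hits (P ∘ (false ∷_)) ws + hits (P ∘ (true ∷_)) ws
  filter-concatMap P [] = refl
  filter-concatMap P (w ∷ ws) = begin
    hits P ((false ∷ w) ∷ (true ∷ w) ∷ concatMap _ ws)
      ≡⟨ trans (hits-∷ P _ _) (cong (a +_) (hits-∷ P _ _)) ⟩
    a + (b + hits P (concatMap _ ws))  ≡⟨ cong (λ r → a + (b + r)) (filter-concatMap P ws) ⟩
    a + (b + (c + d))                  ≡⟨ +-assoc a b (c + d) ⟨
    (a + b) + (c + d)                  ≡⟨ interchange a b c d ⟩
    (a + c) + (b + d)                  ≡⟨ sym (cong₂ _+_ (hits-∷ P₀ w ws) (hits-∷ P₁ w ws)) ⟩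
    hits P₀ (w ∷ ws) + hits P₁ (w ∷ ws) ∎
    where
    P₀ P₁ : List Bool → Bool
    P₀ = P ∘ (false ∷_)
    P₁ = P ∘ (true ∷_)
    a = indicator (P₀ w)
    b = indicator (P₁ w)
    c = hits P₀ ws
    d = hits P₁ ws

sumWords-cong : ∀ n {f g} → (∀ w → length w ≡ n → f w ≡ g w) → sumWords n f ≡ sumWords n g
sumWords-cong zero    f≗g = f≗g [] refl
sumWords-cong (suc n) f≗g = cong₂ _+_ (sumWords-cong n (λ w e → f≗g (false ∷ w) (cong suc e)))
                                      (sumWords-cong n (λ w e → f≗g (true ∷ w) (cong suc e)))

sumWords-++ : ∀ k ℓ f → sumWords (k + ℓ) f ≡ sumWords k (λ u → sumWords ℓ (λ v → f (u ++ v)))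
sumWords-++ zero    ℓ f = refl
sumWords-++ (suc k) ℓ f = cong₂ _+_ (sumWords-++ k ℓ _) (sumWords-++ k ℓ _)

sumWords-+ : ∀ n f g → sumWords n (λ w → f w + g w) ≡ sumWords n f + sumWords n g
sumWords-+ zero    f g = refl
sumWords-+ (suc n) f g = begin
  sumWords n (λ w → f₀ w + g₀ w) + sumWords n (λ w → f₁ w + g₁ w)
    ≡⟨ cong₂ _+_ (sumWords-+ n f₀ g₀) (sumWords-+ n f₁ g₁) ⟩
  (sumWords n f₀ + sumWords n g₀) + (sumWords n f₁ + sumWords n g₁)
    ≡⟨ interchange (sumWords n f₀) (sumWords n g₀) (sumWords n f₁) (sumWords n g₁) ⟩
  (sumWords n f₀ + sumWords n f₁) + (sumWords n g₀ + sumWords n g₁) ∎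
  where
  f₀ = f ∘ (false ∷_)
  f₁ = f ∘ (true ∷_)
  g₀ = g ∘ (false ∷_)
  g₁ = g ∘ (true ∷_)
  open ≡-Reasoning

2^n*c+2^n*c≡2^[1+n]*c : ∀ n c → 2 ^ n * c + 2 ^ n * c ≡ 2 ^ suc n * c
2^n*c+2^n*c≡2^[1+n]*c n c = begin
  2 ^ n * c + 2 ^ n * c ≡⟨ *-distribʳ-+ c (2 ^ n) (2 ^ n) ⟨
  (2 ^ n + 2 ^ n) * c   ≡⟨ cong (λ x → (2 ^ n + x) * c) (+-identityʳ (2 ^ n)) ⟨
  2 * 2 ^ n * c         ∎
  where open ≡-Reasoning

sumWords-const : ∀ n c → sumWords n (λ _ → c) ≡ 2 ^ n * c
sumWords-const zero    c = sym (*-identityˡ c)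
sumWords-const (suc n) c =
  trans (cong₂ _+_ (sumWords-const n c) (sumWords-const n c)) (2^n*c+2^n*c≡2^[1+n]*c n c)

sumWords-mono-≤ : ∀ n {f g} → (∀ w → length w ≡ n → f w ≤ g w) → sumWords n f ≤ sumWords n g
sumWords-mono-≤ zero    f≤g = f≤g [] refl
sumWords-mono-≤ (suc n) f≤g = +-mono-≤ (sumWords-mono-≤ n (λ w e → f≤g (false ∷ w) (cong suc e)))
                                       (sumWords-mono-≤ n (λ w e → f≤g (true ∷ w) (cong suc e)))

sumWords-≤ : ∀ n {f} B → (∀ w → length w ≡ n → f w ≤ B) → sumWords n f ≤ 2 ^ n * B
sumWords-≤ n B f≤B = ≤-trans (sumWords-mono-≤ n f≤B) (≤-reflexive (sumWords-const n B))

sumWords-≤-vanishing : ∀ n {f} B → (∀ w → length w ≡ n → f w ≤ B) →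
  ∀ u → length u ≡ n → f u ≡ 0 → sumWords n f ≤ (2 ^ n ∸ 1) * B
sumWords-≤-vanishing n {f} B f≤B u |u| fu≡0 = begin
  sumWords n f      ≤⟨ m+n≤o⇒m≤o∸n (sumWords n f) (sumWords+B≤ n f≤B u |u| fu≡0) ⟩
  2 ^ n * B ∸ B     ≡⟨ cong (2 ^ n * B ∸_) (*-identityˡ B) ⟨
  2 ^ n * B ∸ 1 * B ≡⟨ *-distribʳ-∸ B (2 ^ n) 1 ⟨
  (2 ^ n ∸ 1) * B   ∎
  where
  open ≤-Reasoning
  sumWords+B≤ : ∀ n {f} → (∀ w → length w ≡ n → f w ≤ B) →
    ∀ u → length u ≡ n → f u ≡ 0 → sumWords n f + B ≤ 2 ^ n * B
  sumWords+B≤ zero f≤B [] _ fu≡0 rewrite fu≡0 = ≤-reflexive (sym (+-identityʳ B))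
  sumWords+B≤ (suc n) {f} f≤B (false ∷ u) |u| fu≡0 = begin
    (x + y) + B ≡⟨ +-assoc x y B ⟩
    x + (y + B) ≡⟨ cong (x +_) (+-comm y B) ⟩
    x + (B + y) ≡⟨ +-assoc x B y ⟨
    (x + B) + y ≤⟨ +-mono-≤ (sumWords+B≤ n (λ w e → f≤B (false ∷ w) (cong suc e)) u (suc-injective |u|) fu≡0)
                            (sumWords-≤ n B (λ w e → f≤B (true ∷ w) (cong suc e))) ⟩
    2 ^ n * B + 2 ^ n * B ≡⟨ 2^n*c+2^n*c≡2^[1+n]*c n B ⟩
    2 ^ suc n * B ∎
    where
    x = sumWords n (f ∘ (false ∷_))
    y = sumWords n (f ∘ (true ∷_))
  sumWords+B≤ (suc n) {f} f≤B (true ∷ u) |u| fu≡0 = begin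
    (x + y) + B ≡⟨ +-assoc x y B ⟩
    x + (y + B) ≤⟨ +-mono-≤ (sumWords-≤ n B (λ w e → f≤B (false ∷ w) (cong suc e)))
                            (sumWords+B≤ n (λ w e → f≤B (true ∷ w) (cong suc e)) u (suc-injective |u|) fu≡0) ⟩
    2 ^ n * B + 2 ^ n * B ≡⟨ 2^n*c+2^n*c≡2^[1+n]*c n B ⟩
    2 ^ suc n * B ∎
    where
    x = sumWords n (f ∘ (false ∷_))
    y = sumWords n (f ∘ (true ∷_))

sumWords-positive : ∀ n f → 0 < sumWords n f → Σ (List Bool) λ w → length w ≡ n × 0 < f w
sumWords-positive zero    f 0<f = [] , refl , 0<f
sumWords-positive (suc n) f 0<Σ with sumWords n (f ∘ (false ∷_)) in eq
... | suc _ = let w , |w| , 0<fw = sumWords-positive n (f ∘ (false ∷_)) (≤-trans (s≤s z≤n) (≤-reflexive (sym eq)))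
              in false ∷ w , cong suc |w| , 0<fw
... | zero  = let w , |w| , 0<fw = sumWords-positive n (f ∘ (true ∷_)) 0<Σ
              in true ∷ w , cong suc |w| , 0<fw

-- Binomial coefficients and the central bound

ones : List Bool → ℕ
ones []          = 0
ones (true  ∷ w) = suc (ones w)
ones (false ∷ w) = ones w

nC0≡1 : ∀ n → n C 0 ≡ 1
nC0≡1 n = trans (nCk≡nC[n∸k] {0} {n} z≤n) (nCn≡1 n)

pascal : ∀ n k → suc n C suc k ≡ n C k + n C suc k
pascal n k = sym (nCk+nC[k+1]≡[n+1]C[k+1] n k)

sumWords-ones≡ : ∀ n k → sumWords n (indicator ∘ (λ w → ones w ≡ᵇ k)) ≡ n C k
sumWords-ones≡ zero    zero    = refl
sumWords-ones≡ zero    (suc k) = refl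
sumWords-ones≡ (suc n) zero    = begin
  sumWords n (indicator ∘ (λ w → ones w ≡ᵇ 0)) + sumWords n (λ _ → 0)
    ≡⟨ cong₂ _+_ (sumWords-ones≡ n 0) (trans (sumWords-const n 0) (*-zeroʳ (2 ^ n))) ⟩
  n C 0 + 0      ≡⟨ trans (+-identityʳ (n C 0)) (nC0≡1 n) ⟩
  1              ≡⟨ nC0≡1 (suc n) ⟨
  suc n C 0      ∎
  where open ≡-Reasoning
sumWords-ones≡ (suc n) (suc k) =
  trans (cong₂ _+_ (sumWords-ones≡ n (suc k)) (sumWords-ones≡ n k))
        (trans (+-comm (n C suc k) (n C k)) (sym (pascal n k)))

absorption : ∀ n k → suc k * (n C suc k) + k * (n C k) ≡ n * (n C k)
absorption zero    zero    = refl
absorption zero    (suc k) = cong₂ _+_ (*-zeroʳ (suc (suc k))) (*-zeroʳ (suc k))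
absorption (suc n) zero    = begin
  1 * (suc n C 1) + 0 ≡⟨ trans (+-identityʳ _) (*-identityˡ _) ⟩
  suc n C 1           ≡⟨ nC1≡n (suc n) ⟩
  suc n               ≡⟨ *-identityʳ (suc n) ⟨
  suc n * 1           ≡⟨ cong (suc n *_) (nC0≡1 (suc n)) ⟨
  suc n * (suc n C 0) ∎
  where open ≡-Reasoning
absorption (suc n) (suc k) = begin
  suc (suc k) * (suc n C suc (suc k)) + suc k * (suc n C suc k)
    ≡⟨ cong₂ (λ x y → suc (suc k) * x + suc k * y) (pascal n (suc k)) (pascal n k) ⟩
  suc (suc k) * (b₁ + b₂) + suc k * (b₀ + b₁)
    ≡⟨ regroup₁ k b₀ b₁ b₂ ⟩
  (suc (suc k) * b₂ + suc k * b₁) + (suc (suc k) * b₁ + suc k * b₀)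
    ≡⟨ cong (_+ (suc (suc k) * b₁ + suc k * b₀)) (absorption n (suc k)) ⟩
  n * b₁ + (suc (suc k) * b₁ + suc k * b₀)
    ≡⟨ regroup₂ n k b₀ b₁ ⟩
  b₀ + b₁ + (suc k * b₁ + k * b₀) + n * b₁
    ≡⟨ cong (λ x → b₀ + b₁ + x + n * b₁) (absorption n k) ⟩
  b₀ + b₁ + n * b₀ + n * b₁
    ≡⟨ regroup₃ n b₀ b₁ ⟩
  suc n * (b₀ + b₁)
    ≡⟨ cong (suc n *_) (pascal n k) ⟨
  suc n * (suc n C suc k) ∎
  where
  open ≡-Reasoning
  b₀ = n C k
  b₁ = n C suc k
  b₂ = n C suc (suc k)
  regroup₁ : ∀ k b₀ b₁ b₂ → suc (suc k) * (b₁ + b₂) + suc k * (b₀ + b₁)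
                          ≡ (suc (suc k) * b₂ + suc k * b₁) + (suc (suc k) * b₁ + suc k * b₀)
  regroup₁ = solve-∀
  regroup₂ : ∀ n k b₀ b₁ → n * b₁ + (suc (suc k) * b₁ + suc k * b₀) ≡ b₀ + b₁ + (suc k * b₁ + k * b₀) + n * b₁
  regroup₂ = solve-∀
  regroup₃ : ∀ n b₀ b₁ → b₀ + b₁ + n * b₀ + n * b₁ ≡ suc n * (b₀ + b₁)
  regroup₃ = solve-∀

[m+1]*[2m+1]C[m+1]≡[2m+1]*[2m]Cm : ∀ m → suc m * (suc (m + m) C suc m) ≡ suc (m + m) * ((m + m) C m)
[m+1]*[2m+1]C[m+1]≡[2m+1]*[2m]Cm m = begin
  suc m * (suc (m + m) C suc m)   ≡⟨ cong (suc m *_) (pascal (m + m) m) ⟩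
  suc m * (c₀ + c₁)               ≡⟨ *-distribˡ-+ (suc m) c₀ c₁ ⟩
  suc m * c₀ + suc m * c₁         ≡⟨ cong (suc m * c₀ +_) halfway ⟩
  suc m * c₀ + m * c₀             ≡⟨ *-distribʳ-+ c₀ (suc m) m ⟨
  suc (m + m) * c₀                ∎
  where
  open ≡-Reasoning
  c₀ = (m + m) C m
  c₁ = (m + m) C suc m
  halfway : suc m * c₁ ≡ m * c₀
  halfway = +-cancelʳ-≡ (m * c₀) _ _ (begin
    suc m * c₁ + m * c₀ ≡⟨ absorption (m + m) m ⟩
    (m + m) * c₀        ≡⟨ *-distribʳ-+ c₀ m m ⟩
    m * c₀ + m * c₀     ∎)

[2m+2]C[m+1]≡2*[2m+1]C[m+1] : ∀ m → (suc m + suc m) C suc m ≡ 2 * (suc (m + m) C suc m)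
[2m+2]C[m+1]≡2*[2m+1]C[m+1] m = begin
  (suc m + suc m) C suc m                        ≡⟨ cong (λ n → suc n C suc m) (+-suc m m) ⟩
  suc (suc (m + m)) C suc m                      ≡⟨ pascal (suc (m + m)) m ⟩
  suc (m + m) C m + suc (m + m) C suc m          ≡⟨ cong (_+ suc (m + m) C suc m) symmetric ⟩
  suc (m + m) C suc m + suc (m + m) C suc m      ≡⟨ cong (suc (m + m) C suc m +_) (+-identityʳ _) ⟨
  2 * (suc (m + m) C suc m)                      ∎
  where
  open ≡-Reasoning
  symmetric : suc (m + m) C m ≡ suc (m + m) C suc m
  symmetric = trans (nCk≡nC[n∸k] (m≤n+m m (suc m))) (cong (suc (m + m) C_) (m+n∸n≡m (suc m) m))

2*[2m]Cm*[2m+1]≡[2m+1]C[m+1]*[2m+2] : ∀ m → 2 * (((m + m) C m) * suc (m + m)) ≡ (suc (m + m) C suc m) * suc (suc (m + m))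
2*[2m]Cm*[2m+1]≡[2m+1]C[m+1]*[2m+2] m = begin
  2 * (((m + m) C m) * suc (m + m))        ≡⟨ cong (2 *_) (*-comm ((m + m) C m) (suc (m + m))) ⟩
  2 * (suc (m + m) * ((m + m) C m))        ≡⟨ cong (2 *_) ([m+1]*[2m+1]C[m+1]≡[2m+1]*[2m]Cm m) ⟨
  2 * (suc m * c)                          ≡⟨ regroup m c ⟩
  c * suc (suc (m + m))                    ∎
  where
  open ≡-Reasoning
  c = suc (m + m) C suc m
  regroup : ∀ m c → 2 * (suc m * c) ≡ c * suc (suc (m + m))
  regroup = solve-∀

2*[2m+1]C[m+1]*[2m+2]≤[2m+2]C[m+1]*[2m+3] : ∀ m → 2 * ((suc (m + m) C suc m) * suc (suc (m + m))) ≤ ((suc m + suc m) C suc m) * suc (suc m + suc m)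
2*[2m+1]C[m+1]*[2m+2]≤[2m+2]C[m+1]*[2m+3] m = begin
  2 * (c * suc (suc (m + m)))           ≡⟨ *-assoc 2 c _ ⟨
  2 * c * suc (suc (m + m))             ≤⟨ *-monoʳ-≤ (2 * c) (n≤1+n _) ⟩
  2 * c * suc (suc (suc (m + m)))       ≡⟨ cong (λ n → 2 * c * suc (suc n)) (+-suc m m) ⟨
  2 * c * suc (suc m + suc m)           ≡⟨ cong (_* suc (suc m + suc m)) ([2m+2]C[m+1]≡2*[2m+1]C[m+1] m) ⟨
  ((suc m + suc m) C suc m) * suc (suc m + suc m) ∎
  where
  open ≤-Reasoning
  c = suc (m + m) C suc m

2^[2m]≤[2m]Cm*[2m+1] : ∀ m → 2 ^ (m + m) ≤ ((m + m) C m) * suc (m + m)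
2^[2m+1]≤[2m+1]C[m+1]*[2m+2] : ∀ m → 2 ^ suc (m + m) ≤ (suc (m + m) C suc m) * suc (suc (m + m))

2^[2m]≤[2m]Cm*[2m+1] zero    = ≤-refl
2^[2m]≤[2m]Cm*[2m+1] (suc m) = begin
  2 ^ (suc m + suc m)                                   ≡⟨ cong (2 ^_) (cong suc (+-suc m m)) ⟩
  2 * 2 ^ suc (m + m)                                   ≤⟨ *-monoʳ-≤ 2 (2^[2m+1]≤[2m+1]C[m+1]*[2m+2] m) ⟩
  2 * ((suc (m + m) C suc m) * suc (suc (m + m)))       ≤⟨ 2*[2m+1]C[m+1]*[2m+2]≤[2m+2]C[m+1]*[2m+3] m ⟩
  ((suc m + suc m) C suc m) * suc (suc m + suc m)       ∎
  where open ≤-Reasoning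

2^[2m+1]≤[2m+1]C[m+1]*[2m+2] m = begin
  2 * 2 ^ (m + m)                            ≤⟨ *-monoʳ-≤ 2 (2^[2m]≤[2m]Cm*[2m+1] m) ⟩
  2 * (((m + m) C m) * suc (m + m))          ≡⟨ 2*[2m]Cm*[2m+1]≡[2m+1]C[m+1]*[2m+2] m ⟩
  (suc (m + m) C suc m) * suc (suc (m + m))  ∎
  where open ≤-Reasoning

data EvenOrOdd : ℕ → Set where
  even : ∀ m → EvenOrOdd (m + m)
  odd  : ∀ m → EvenOrOdd (suc (m + m))

evenOrOdd : ∀ n → EvenOrOdd n
evenOrOdd zero = even 0
evenOrOdd (suc n) with evenOrOdd n
... | even m = odd m
... | odd  m = subst EvenOrOdd (cong suc (+-suc m m)) (even (suc m))

⌈m+m/2⌉≡m : ∀ m → ⌈ m + m /2⌉ ≡ m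
⌈m+m/2⌉≡m zero    = refl
⌈m+m/2⌉≡m (suc m) = trans (cong (⌈_/2⌉ ∘ suc) (+-suc m m)) (cong suc (⌈m+m/2⌉≡m m))

⌈1+m+m/2⌉≡1+m : ∀ m → ⌈ suc (m + m) /2⌉ ≡ suc m
⌈1+m+m/2⌉≡1+m zero    = refl
⌈1+m+m/2⌉≡1+m (suc m) = trans (cong (⌈_/2⌉ ∘ suc ∘ suc) (+-suc m m)) (cong suc (⌈1+m+m/2⌉≡1+m m))

2^n≤nC⌈n/2⌉*[n+1] : ∀ n → 2 ^ n ≤ (n C ⌈ n /2⌉) * suc n
2^n≤nC⌈n/2⌉*[n+1] n = bound (evenOrOdd n)
  where
  bound : ∀ {n} → EvenOrOdd n → 2 ^ n ≤ (n C ⌈ n /2⌉) * suc n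
  bound (even m) = subst (λ k → 2 ^ (m + m) ≤ ((m + m) C k) * suc (m + m))
                         (sym (⌈m+m/2⌉≡m m)) (2^[2m]≤[2m]Cm*[2m+1] m)
  bound (odd m)  = subst (λ k → 2 ^ suc (m + m) ≤ (suc (m + m) C k) * suc (suc (m + m)))
                         (sym (⌈1+m+m/2⌉≡1+m m)) (2^[2m+1]≤[2m+1]C[m+1]*[2m+2] m)

zeros : List Bool → ℕ
zeros []          = 0
zeros (true  ∷ w) = zeros w
zeros (false ∷ w) = suc (zeros w)

length≡ones+zeros : ∀ w → length w ≡ ones w + zeros w
length≡ones+zeros []          = refl
length≡ones+zeros (true  ∷ w) = cong suc (length≡ones+zeros w)
length≡ones+zeros (false ∷ w) = trans (cong suc (length≡ones+zeros w)) (sym (+-suc (ones w) (zeros w)))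

ones-++ : ∀ u v → ones (u ++ v) ≡ ones u + ones v
ones-++ []          v = refl
ones-++ (true  ∷ u) v = cong suc (ones-++ u v)
ones-++ (false ∷ u) v = ones-++ u v

zeros-++ : ∀ u v → zeros (u ++ v) ≡ zeros u + zeros v
zeros-++ []          v = refl
zeros-++ (true  ∷ u) v = zeros-++ u v
zeros-++ (false ∷ u) v = cong suc (zeros-++ u v)

Balanced : List Bool → Set
Balanced w = ones w ≡ zeros w

halfOnes : Language
halfOnes w = ones w ≡ᵇ ⌈ length w /2⌉

count-halfOnes : ∀ n → count halfOnes n ≡ n C ⌈ n /2⌉
count-halfOnes n = begin
  count halfOnes n                                        ≡⟨ count≡sumWords halfOnes n ⟩
  sumWords n (indicator ∘ halfOnes)                      ≡⟨ sumWords-cong n (λ w |w| → cong (λ m → indicator (ones w ≡ᵇ ⌈ m /2⌉)) |w|) ⟩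
  sumWords n (indicator ∘ (λ w → ones w ≡ᵇ ⌈ n /2⌉))      ≡⟨ sumWords-ones≡ n ⌈ n /2⌉ ⟩
  n C ⌈ n /2⌉                                             ∎
  where open ≡-Reasoning

halfOnes-pdense : PDense halfOnes
halfOnes-pdense = 0 , 1 ∷ 1 ∷ [] , here (λ ()) , λ n _ → begin
  2 ^ n                              ≤⟨ 2^n≤nC⌈n/2⌉*[n+1] n ⟩
  (n C ⌈ n /2⌉) * suc n              ≡⟨ cong₂ _*_ (count-halfOnes n) (cong suc (*-identityʳ n)) ⟨
  count halfOnes n * (1 + n * 1)     ≡⟨ cong (λ m → count halfOnes n * (1 + n * suc m)) (*-zeroʳ n) ⟨
  count halfOnes n * eval (1 ∷ 1 ∷ []) n ∎
  where open ≤-Reasoning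

⌈m+n/2⌉≡m⇔m≡n⊎m≡1+n : ∀ m n → ⌈ m + n /2⌉ ≡ m ⇔ (m ≡ n ⊎ m ≡ suc n)
⌈m+n/2⌉≡m⇔m≡n⊎m≡1+n m n = mk⇔ (to m n) from
  where
  to : ∀ m n → ⌈ m + n /2⌉ ≡ m → m ≡ n ⊎ m ≡ suc n
  to zero          zero    _ = inj₁ refl
  to zero          (suc n) ()
  to (suc zero)    zero    _ = inj₂ refl
  to (suc (suc m)) zero    e = ⊥-elim (<-irrefl refl (begin-strict
    suc m            ≡⟨ suc-injective e ⟨
    ⌈ m + 0 /2⌉      ≤⟨ ⌈n/2⌉≤n (m + 0) ⟩
    m + 0            ≡⟨ +-identityʳ m ⟩
    m                <⟨ n<1+n m ⟩
    suc m            ∎))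
    where open ≤-Reasoning
  to (suc m)       (suc n) e with to m n (suc-injective (trans (cong (⌈_/2⌉ ∘ suc) (sym (+-suc m n))) e))
  ... | inj₁ m≡n  = inj₁ (cong suc m≡n)
  ... | inj₂ m≡1+n = inj₂ (cong suc m≡1+n)
  from : m ≡ n ⊎ m ≡ suc n → ⌈ m + n /2⌉ ≡ m
  from (inj₁ refl) = ⌈m+m/2⌉≡m m
  from (inj₂ refl) = ⌈1+m+m/2⌉≡1+m n

halfOnes⇔ : ∀ w → T (halfOnes w) ⇔ (Balanced w ⊎ ones w ≡ suc (zeros w))
halfOnes⇔ w = mk⇔
  (λ t → to (sym (trans (≡ᵇ⇒≡ (ones w) _ t) (cong ⌈_/2⌉ (length≡ones+zeros w)))))
  (λ b → ≡⇒≡ᵇ (ones w) _ (trans (sym (from b)) (cong ⌈_/2⌉ (sym (length≡ones+zeros w)))))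
  where open Equivalence (⌈m+n/2⌉≡m⇔m≡n⊎m≡1+n (ones w) (zeros w))

-- A context-free grammar

split-at-one : ∀ j w → suc j + zeros w ≤ ones w →
  Σ (List Bool) λ u → Σ (List Bool) λ v → w ≡ u ++ true ∷ v × ones u ≡ j + zeros u
split-at-one zero    (true ∷ w)  _         = [] , w , refl , refl
split-at-one (suc j) (true ∷ w)  (s≤s j≤) with split-at-one j w j≤
... | u , v , refl , eq = true ∷ u , v , refl , cong suc eq
split-at-one j       (false ∷ w) j≤ with split-at-one (suc j) w (≤-trans (≤-reflexive (sym (+-suc (suc j) (zeros w)))) j≤)
... | u , v , refl , eq = false ∷ u , v , refl , trans eq (sym (+-suc j (zeros u)))

split-at-zero : ∀ j w → suc j + ones w ≤ zeros w →
  Σ (List Bool) λ u → Σ (List Bool) λ v → w ≡ u ++ false ∷ v × zeros u ≡ j + ones u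
split-at-zero zero    (false ∷ w) _         = [] , w , refl , refl
split-at-zero (suc j) (false ∷ w) (s≤s j≤) with split-at-zero j w j≤
... | u , v , refl , eq = false ∷ u , v , refl , cong suc eq
split-at-zero j       (true ∷ w)  j≤ with split-at-zero (suc j) w (≤-trans (≤-reflexive (sym (+-suc (suc j) (ones w)))) j≤)
... | u , v , refl , eq = true ∷ u , v , refl , trans eq (sym (+-suc j (ones u)))

surplus-one-split : ∀ w → ones w ≡ suc (zeros w) →
  Σ (List Bool) λ u → Σ (List Bool) λ v → w ≡ u ++ true ∷ v × Balanced u × Balanced v
surplus-one-split w e with split-at-one 0 w (≤-reflexive (sym e))
... | u , v , refl , bu = u , v , refl , bu , +-cancelˡ-≡ (suc (ones u)) _ _ (begin
  suc (ones u) + ones v        ≡⟨ +-suc (ones u) (ones v) ⟨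
  ones u + suc (ones v)        ≡⟨ ones-++ u (true ∷ v) ⟨
  ones (u ++ true ∷ v)         ≡⟨ e ⟩
  suc (zeros (u ++ true ∷ v))  ≡⟨ cong suc (zeros-++ u (true ∷ v)) ⟩
  suc (zeros u + zeros v)      ≡⟨ cong (λ k → suc k + zeros v) bu ⟨
  suc (ones u) + zeros v       ∎)
  where open ≡-Reasoning

surplus-zero-split : ∀ w → zeros w ≡ suc (ones w) →
  Σ (List Bool) λ u → Σ (List Bool) λ v → w ≡ u ++ false ∷ v × Balanced u × Balanced v
surplus-zero-split w e with split-at-zero 0 w (≤-reflexive (sym e))
... | u , v , refl , bu = u , v , refl , sym bu , sym (+-cancelˡ-≡ (suc (zeros u)) _ _ (begin
  suc (zeros u) + zeros v      ≡⟨ +-suc (zeros u) (zeros v) ⟨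
  zeros u + suc (zeros v)      ≡⟨ zeros-++ u (false ∷ v) ⟨
  zeros (u ++ false ∷ v)       ≡⟨ e ⟩
  suc (ones (u ++ false ∷ v))  ≡⟨ cong suc (ones-++ u (false ∷ v)) ⟩
  suc (ones u + ones v)        ≡⟨ cong (λ k → suc k + ones v) bu ⟨
  suc (zeros u) + ones v       ∎))
  where open ≡-Reasoning

join-one : ∀ u v → Balanced u → Balanced v → ones (u ++ true ∷ v) ≡ suc (zeros (u ++ true ∷ v))
join-one u v bu bv = begin
  ones (u ++ true ∷ v)        ≡⟨ ones-++ u (true ∷ v) ⟩
  ones u + suc (ones v)       ≡⟨ cong₂ (λ x y → x + suc y) bu bv ⟩
  zeros u + suc (zeros v)     ≡⟨ +-suc (zeros u) (zeros v) ⟩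
  suc (zeros u + zeros v)     ≡⟨ cong suc (zeros-++ u (true ∷ v)) ⟨
  suc (zeros (u ++ true ∷ v)) ∎
  where open ≡-Reasoning

join-zero : ∀ u v → Balanced u → Balanced v → zeros (u ++ false ∷ v) ≡ suc (ones (u ++ false ∷ v))
join-zero u v bu bv = begin
  zeros (u ++ false ∷ v)      ≡⟨ zeros-++ u (false ∷ v) ⟩
  zeros u + suc (zeros v)     ≡⟨ cong₂ (λ x y → x + suc y) bu bv ⟨
  ones u + suc (ones v)       ≡⟨ +-suc (ones u) (ones v) ⟩
  suc (ones u + ones v)       ≡⟨ cong suc (ones-++ u (false ∷ v)) ⟨
  suc (ones (u ++ false ∷ v)) ∎
  where open ≡-Reasoning

pattern Start = #0
pattern Bal   = #suc #0

halfOnesGrammar : CFG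
halfOnesGrammar = record
  { nonterminals = 2
  ; rules = (Start , inj₁ Bal ∷ [])
          ∷ (Start , inj₁ Bal ∷ inj₂ true ∷ inj₁ Bal ∷ [])
          ∷ (Bal , [])
          ∷ (Bal , inj₂ false ∷ inj₁ Bal ∷ inj₂ true ∷ inj₁ Bal ∷ [])
          ∷ (Bal , inj₂ true ∷ inj₁ Bal ∷ inj₂ false ∷ inj₁ Bal ∷ [])
          ∷ []
  ; start = Start
  }

pattern S⇒B    = here refl
pattern S⇒B1B  = there (here refl)
pattern B⇒ε    = there (there (here refl))
pattern B⇒0B1B = there (there (there (here refl)))
pattern B⇒1B0B = there (there (there (there (here refl))))

Derives : Fin 2 → List Bool → Set
Derives = Gen halfOnesGrammar

Meaning : Fin 2 → List Bool → Set
Meaning Start w = T (halfOnes w)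
Meaning Bal   w = Balanced w

derives-sound : ∀ {X w} → Derives X w → Meaning X w
derives-sound (rule S⇒B (nt {u = u} d [])) rewrite ++-identityʳ u =
  Equivalence.from (halfOnes⇔ u) (inj₁ (derives-sound d))
derives-sound (rule S⇒B1B (nt {u = u} d (term (nt {u = v} e [])))) rewrite ++-identityʳ v =
  Equivalence.from (halfOnes⇔ (u ++ true ∷ v)) (inj₂ (join-one u v (derives-sound d) (derives-sound e)))
derives-sound (rule B⇒ε []) = refl
derives-sound (rule B⇒0B1B (term (nt {u = u} d (term (nt {u = v} e []))))) rewrite ++-identityʳ v =
  join-one u v (derives-sound d) (derives-sound e)
derives-sound (rule B⇒1B0B (term (nt {u = u} d (term (nt {u = v} e []))))) rewrite ++-identityʳ v =
  sym (join-zero u v (derives-sound d) (derives-sound e))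
derives-sound (rule (there (there (there (there (there ()))))) _)

piece-≤ˡ : ∀ {n} u {c : Bool} {v} → length (u ++ c ∷ v) ≤ n → length u ≤ n
piece-≤ˡ u = ≤-trans (length-++-≤ˡ u)

piece-≤ʳ : ∀ {n} u {c : Bool} v → length (u ++ c ∷ v) ≤ n → length v ≤ n
piece-≤ʳ u {c} v = ≤-trans (≤-trans (n≤1+n (length v)) (length-++-≤ʳ (c ∷ v) {u}))

balanced⇒derives : ∀ n w → length w ≤ n → Balanced w → Derives Bal w
balanced⇒derives _       []          _          _ = rule B⇒ε []
balanced⇒derives (suc n) (false ∷ w) (s≤s |w|≤n) b with surplus-one-split w b
... | u , v , refl , bu , bv = subst (Derives Bal) (cong (λ x → false ∷ u ++ true ∷ x) (++-identityʳ v))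
  (rule B⇒0B1B (term (nt (balanced⇒derives n u (piece-≤ˡ u |w|≤n) bu)
                     (term (nt (balanced⇒derives n v (piece-≤ʳ u v |w|≤n) bv) [])))))
balanced⇒derives (suc n) (true ∷ w)  (s≤s |w|≤n) b with surplus-zero-split w (sym b)
... | u , v , refl , bu , bv = subst (Derives Bal) (cong (λ x → true ∷ u ++ false ∷ x) (++-identityʳ v))
  (rule B⇒1B0B (term (nt (balanced⇒derives n u (piece-≤ˡ u |w|≤n) bu)
                     (term (nt (balanced⇒derives n v (piece-≤ʳ u v |w|≤n) bv) [])))))

halfOnes⇒derives : ∀ w → T (halfOnes w) → Derives Start w
halfOnes⇒derives w t with Equivalence.to (halfOnes⇔ w) t
... | inj₁ b = subst (Derives Start) (++-identityʳ w) (rule S⇒B (nt (balanced⇒derives _ w ≤-refl b) []))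
... | inj₂ e with surplus-one-split w e
...   | u , v , refl , bu , bv = subst (Derives Start) (cong (λ x → u ++ true ∷ x) (++-identityʳ v))
  (rule S⇒B1B (nt (balanced⇒derives _ u ≤-refl bu) (term (nt (balanced⇒derives _ v ≤-refl bv) []))))

halfOnes-cfl : CFL halfOnes
halfOnes-cfl = halfOnesGrammar , λ w → mk⇔ (halfOnes⇒derives w) derives-sound

-- An advice automaton rejecting the whole language

open Inverse 2↔Bool using () renaming (to to bit; from to fromBit; strictlyInverseˡ to bit∘fromBit)

oddᵇ : ℕ → Bool
oddᵇ zero    = false
oddᵇ (suc n) = not (oddᵇ n)

parity : List Bool → Bool
parity = foldr _xor_ false

parity≡oddᵇ∘ones : ∀ w → parity w ≡ oddᵇ (ones w)
parity≡oddᵇ∘ones []          = refl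
parity≡oddᵇ∘ones (true  ∷ w) = cong not (parity≡oddᵇ∘ones w)
parity≡oddᵇ∘ones (false ∷ w) = parity≡oddᵇ∘ones w

weight : Bool × Fin 2 → Bool
weight (b , g) = b xor bit g

parityDFA : DFA (Bool × Fin 2)
parityDFA = record
  { states = 2
  ; start  = fromBit false
  ; δ      = λ q bg → fromBit (bit q xor weight bg)
  ; final  = bit
  }

run-parityDFA : ∀ q l → bit (run parityDFA q l) ≡ bit q xor parity (map weight l)
run-parityDFA q []      = sym (xor-identityʳ (bit q))
run-parityDFA q (x ∷ l) = begin
  bit (run parityDFA (fromBit (bit q xor weight x)) l)    ≡⟨ run-parityDFA _ l ⟩
  bit (fromBit (bit q xor weight x)) xor parity (map weight l)
    ≡⟨ cong (_xor parity (map weight l)) (bit∘fromBit (bit q xor weight x)) ⟩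
  (bit q xor weight x) xor parity (map weight l)         ≡⟨ xor-assoc (bit q) (weight x) _ ⟩
  bit q xor parity (map weight (x ∷ l))                  ∎
  where open ≡-Reasoning

hint : (n : ℕ) → Vec (Fin 2) n
hint zero    = []ᵥ
hint (suc n) = fromBit (oddᵇ ⌈ suc n /2⌉) ∷ᵥ replicateᵥ n (fromBit false)

wrongParity : Language
wrongParity x = accepts parityDFA (zip x (toList (hint (length x))))

wrongParity-reg : REG/n wrongParity
wrongParity-reg = 2 , hint , parityDFA , λ x → refl

wrongParity≡ : ∀ x → wrongParity x ≡ parity x xor oddᵇ ⌈ length x /2⌉
wrongParity≡ []      = refl
wrongParity≡ (b ∷ x) = begin
  wrongParity (b ∷ x)                          ≡⟨ run-parityDFA (fromBit false) (zip (b ∷ x) (toList (hint (suc (length x))))) ⟩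
  (b xor bit (fromBit τ)) xor parity (map weight (zip x (toList (replicateᵥ (length x) (fromBit false)))))
    ≡⟨ cong₂ (λ t p → (b xor t) xor p) (bit∘fromBit τ) (unhinted x) ⟩
  (b xor τ) xor parity x                       ≡⟨ xor-assoc b τ (parity x) ⟩
  b xor (τ xor parity x)                       ≡⟨ cong (b xor_) (xor-comm τ (parity x)) ⟩
  b xor (parity x xor τ)                       ≡⟨ xor-assoc b (parity x) τ ⟨
  parity (b ∷ x) xor τ                         ∎
  where
  open ≡-Reasoning
  τ = oddᵇ ⌈ suc (length x) /2⌉
  unhinted : ∀ x → parity (map weight (zip x (toList (replicateᵥ (length x) (fromBit false))))) ≡ parity x
  unhinted []      = refl
  unhinted (b ∷ x) = cong₂ _xor_ (xor-identityʳ b) (unhinted x)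

halfOnes∩wrongParity≡∅ : ∀ w → (halfOnes ∩ wrongParity) w ≡ false
halfOnes∩wrongParity≡∅ w with halfOnes w in eq
... | false = refl
... | true  = begin
  wrongParity w                                ≡⟨ wrongParity≡ w ⟩
  parity w xor oddᵇ ⌈ length w /2⌉             ≡⟨ cong (_xor oddᵇ ⌈ length w /2⌉) (parity≡oddᵇ∘ones w) ⟩
  oddᵇ (ones w) xor oddᵇ ⌈ length w /2⌉        ≡⟨ cong (λ k → oddᵇ k xor oddᵇ ⌈ length w /2⌉) ones≡ ⟩
  oddᵇ ⌈ length w /2⌉ xor oddᵇ ⌈ length w /2⌉  ≡⟨ xor-same (oddᵇ ⌈ length w /2⌉) ⟩
  false                                        ∎
  where
  open ≡-Reasoning
  ones≡ : ones w ≡ ⌈ length w /2⌉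
  ones≡ = ≡ᵇ⇒≡ (ones w) _ (subst T (sym eq) tt)

wrongParity-flip : ∀ w → wrongParity (true ∷ w) ≡ not (wrongParity (false ∷ w))
wrongParity-flip w = begin
  wrongParity (true ∷ w)          ≡⟨ wrongParity≡ (true ∷ w) ⟩
  not (parity w) xor τ            ≡⟨ not-distribˡ-xor (parity w) τ ⟨
  not (parity w xor τ)            ≡⟨ cong not (wrongParity≡ (false ∷ w)) ⟨
  not (wrongParity (false ∷ w))   ∎
  where
  open ≡-Reasoning
  τ = oddᵇ ⌈ suc (length w) /2⌉

count-wrongParity : ∀ n → count wrongParity (suc n) ≡ 2 ^ n
count-wrongParity n = begin
  count wrongParity (suc n)                            ≡⟨ count≡sumWords wrongParity (suc n) ⟩
  sumWords n (indicator ∘ a) + sumWords n (indicator ∘ wrongParity ∘ (true ∷_))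
    ≡⟨ cong (sumWords n (indicator ∘ a) +_) (sumWords-cong n (λ w _ → cong indicator (wrongParity-flip w))) ⟩
  sumWords n (indicator ∘ a) + sumWords n (indicator ∘ not ∘ a)
    ≡⟨ sumWords-+ n (indicator ∘ a) (indicator ∘ not ∘ a) ⟨
  sumWords n (λ w → indicator (a w) + indicator (not (a w)))
    ≡⟨ sumWords-cong n (λ w _ → indicator-not (a w)) ⟩
  sumWords n (λ _ → 1)                                 ≡⟨ sumWords-const n 1 ⟩
  2 ^ n * 1                                            ≡⟨ *-identityʳ (2 ^ n) ⟩
  2 ^ n                                                ∎
  where
  open ≡-Reasoning
  a = wrongParity ∘ (false ∷_)

wrongParity-pdense : PDense wrongParity
wrongParity-pdense = 1 , 2 ∷ [] , here (λ ()) , λ { (suc n) _ → ≤-reflexive (dense n) }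
  where
  open ≡-Reasoning
  dense : ∀ n → 2 ^ suc n ≡ count wrongParity (suc n) * eval (2 ∷ []) (suc n)
  dense n = sym (begin
    count wrongParity (suc n) * (2 + suc n * 0) ≡⟨ cong₂ _*_ (count-wrongParity n) (cong (2 +_) (*-zeroʳ (suc n))) ⟩
    2 ^ n * 2                                   ≡⟨ *-comm (2 ^ n) 2 ⟩
    2 ^ suc n                                   ∎)

ratio-zero : ∀ d → ratio 0 d ≡ ℚ.0ℚ
ratio-zero zero    = refl
ratio-zero (suc d) = ℚ.0/n≡0 (suc d)

deviation-halfOnes-wrongParity : ∀ n → deviation halfOnes wrongParity n ≡ ℚ.∣ ℚ.0ℚ ℚ.- ℚ.½ ∣
deviation-halfOnes-wrongParity n = cong (λ r → ℚ.∣ r ℚ.- ℚ.½ ∣) (begin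
  ratio (count (halfOnes ∩ wrongParity) n) (count wrongParity n) ≡⟨ cong (λ c → ratio c (count wrongParity n)) empty ⟩
  ratio 0 (count wrongParity n)                                  ≡⟨ ratio-zero (count wrongParity n) ⟩
  ℚ.0ℚ                                                           ∎)
  where
  open ≡-Reasoning
  empty : count (halfOnes ∩ wrongParity) n ≡ 0
  empty = begin
    count (halfOnes ∩ wrongParity) n ≡⟨ count≡sumWords (halfOnes ∩ wrongParity) n ⟩
    sumWords n (indicator ∘ (halfOnes ∩ wrongParity))
      ≡⟨ sumWords-cong n (λ w _ → cong indicator (halfOnes∩wrongParity≡∅ w)) ⟩
    sumWords n (λ _ → 0)              ≡⟨ sumWords-const n 0 ⟩
    2 ^ n * 0                         ≡⟨ *-zeroʳ (2 ^ n) ⟩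
    0                                 ∎

halfOnes-not-pseudorandom : ¬ WeakPseudorandom halfOnes
halfOnes-not-pseudorandom wp with wp wrongParity wrongParity-reg wrongParity-pdense (3 ∷ []) (here (λ ()))
... | n₀ , bound = ½*3≰1 (subst (ℚ._≤ ℚ.1ℚ)
        (cong₂ ℚ._*_ (deviation-halfOnes-wrongParity n₀) (cong (toℚ ∘ (3 +_)) (*-zeroʳ n₀)))
        (bound n₀ ≤-refl))
  where
  ½*3≰1 : ¬ (ℚ.∣ ℚ.0ℚ ℚ.- ℚ.½ ∣ ℚ.* toℚ 3 ℚ.≤ ℚ.1ℚ)
  ½*3≰1 = toWitnessFalse {a? = ℚ.∣ ℚ.0ℚ ℚ.- ℚ.½ ∣ ℚ.* toℚ 3 ℚ.≤? ℚ.1ℚ} tt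

-- Geometric decay against polynomial growth

n<2^n : ∀ n → n < 2 ^ n
n<2^n zero    = s≤s z≤n
n<2^n (suc n) = begin-strict
  suc n           <⟨ s≤s (n<2^n n) ⟩
  suc (2 ^ n)     ≤⟨ +-monoˡ-≤ (2 ^ n) (m^n>0 2 n) ⟩
  2 ^ n + 2 ^ n   ≡⟨ cong (2 ^ n +_) (+-identityʳ (2 ^ n)) ⟨
  2 ^ suc n       ∎
  where open ≤-Reasoning

^-distribʳ-* : ∀ a b n → (a * b) ^ n ≡ a ^ n * b ^ n
^-distribʳ-* a b zero    = refl
^-distribʳ-* a b (suc n) = trans (cong ((a * b) *_) (^-distribʳ-* a b n)) (regroup a b (a ^ n) (b ^ n))
  where
  regroup : ∀ a b x y → a * b * (x * y) ≡ a * x * (b * y)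
  regroup = solve-∀

eval-double : ∀ p x → eval p (2 * x) ≤ 2 ^ length p * eval p x
eval-double []       x = z≤n
eval-double (c ∷ cs) x = begin
  c + 2 * x * eval cs (2 * x)                  ≤⟨ +-monoʳ-≤ c (*-monoʳ-≤ (2 * x) (eval-double cs x)) ⟩
  c + 2 * x * (D * eval cs x)                  ≡⟨ regroup c x D (eval cs x) ⟩
  c + 2 * D * (x * eval cs x)                  ≤⟨ +-monoˡ-≤ _ (m≤n*m c (2 * D) {{m*n≢0 2 D {{_}} {{m^n≢0 2 (length cs)}}}}) ⟩
  2 * D * c + 2 * D * (x * eval cs x)          ≡⟨ *-distribˡ-+ (2 * D) c _ ⟨
  2 * D * (c + x * eval cs x)                  ∎
  where
  open ≤-Reasoning
  D = 2 ^ length cs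
  regroup : ∀ c x D e → c + 2 * x * (D * e) ≡ c + 2 * D * (x * e)
  regroup = solve-∀

eval-2^j* : ∀ p j x → eval p (2 ^ j * x) ≤ (2 ^ length p) ^ j * eval p x
eval-2^j* p zero    x = ≤-reflexive (trans (cong (eval p) (*-identityˡ x)) (sym (*-identityˡ _)))
eval-2^j* p (suc j) x = begin
  eval p (2 * 2 ^ j * x)                    ≡⟨ cong (eval p) (*-assoc 2 (2 ^ j) x) ⟩
  eval p (2 * (2 ^ j * x))                  ≤⟨ eval-double p (2 ^ j * x) ⟩
  D * eval p (2 ^ j * x)                    ≤⟨ *-monoʳ-≤ D (eval-2^j* p j x) ⟩
  D * (D ^ j * eval p x)                    ≡⟨ *-assoc D (D ^ j) (eval p x) ⟨
  D ^ suc j * eval p x                      ∎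
  where
  open ≤-Reasoning
  D = 2 ^ length p

bernoulli : ∀ b c → b ^ c * (b + c) ≤ suc b ^ c * b
bernoulli b zero    = ≤-reflexive (trans (*-identityˡ (b + 0)) (trans (+-identityʳ b) (sym (*-identityˡ b))))
bernoulli b (suc c) = begin
  b * b ^ c * (b + suc c)                   ≡⟨ regroup₁ b (b ^ c) c ⟩
  b ^ c * (b + c) * b + b * b ^ c           ≤⟨ +-monoʳ-≤ (b ^ c * (b + c) * b) (≤-trans (≤-reflexive (*-comm b (b ^ c))) (*-monoʳ-≤ (b ^ c) (m≤m+n b c))) ⟩
  b ^ c * (b + c) * b + b ^ c * (b + c)     ≤⟨ +-mono-≤ (*-monoˡ-≤ b (bernoulli b c)) (bernoulli b c) ⟩
  suc b ^ c * b * b + suc b ^ c * b         ≡⟨ regroup₂ b (suc b ^ c) ⟩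
  suc b * suc b ^ c * b                     ∎
  where
  open ≤-Reasoning
  regroup₁ : ∀ b x c → b * x * (b + suc c) ≡ x * (b + c) * b + b * x
  regroup₁ = solve-∀
  regroup₂ : ∀ b y → y * b * b + y * b ≡ suc b * y * b
  regroup₂ = solve-∀

poly-at-2^j : ∀ S .{{_ : NonZero S}} p x j → eval p x ≤ j →
  S ^ (2 ^ j) * eval p (2 ^ j * x) < (S * (2 * 2 ^ length p)) ^ (2 ^ j)
poly-at-2^j S p x j px≤j = begin-strict
  S ^ E * eval p (E * x)        ≤⟨ *-monoʳ-≤ (S ^ E) (eval-2^j* p j x) ⟩
  S ^ E * (D ^ j * eval p x)    ≤⟨ *-monoʳ-≤ (S ^ E) (*-monoʳ-≤ (D ^ j) px≤j) ⟩
  S ^ E * (D ^ j * j)           <⟨ *-monoʳ-< (S ^ E) {{m^n≢0 S E}} (*-monoʳ-< (D ^ j) {{m^n≢0 D j}} (n<2^n j)) ⟩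
  S ^ E * (D ^ j * 2 ^ j)       ≡⟨ cong (S ^ E *_) (trans (*-comm (D ^ j) (2 ^ j)) (sym (^-distribʳ-* 2 D j))) ⟩
  S ^ E * (2 * D) ^ j           ≤⟨ *-monoʳ-≤ (S ^ E) (^-monoʳ-≤ (2 * D) {{m*n≢0 2 D}} (<⇒≤ (n<2^n j))) ⟩
  S ^ E * (2 * D) ^ E           ≡⟨ ^-distribʳ-* S (2 * D) E ⟨
  (S * (2 * D)) ^ E             ∎
  where
  open ≤-Reasoning
  D = 2 ^ length p
  E = 2 ^ j
  instance
    D≢0 : NonZero D
    D≢0 = m^n≢0 2 (length p)

-- With t = c·2ʲ for c = 2·2^(length p)·b, Bernoulli's inequality makes (1+b)ᵗ/bᵗ at least
-- (2·2^(length p))^(2ʲ), while repeated doubling gives p(k·t) ≤ (2^(length p))ʲ·p(k·c),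
-- which is smaller once j exceeds p(k·c).
geometric-beats-polynomial : ∀ b k p n₀ .{{_ : NonZero b}} .{{_ : NonZero k}} →
  Σ ℕ λ t → n₀ ≤ k * t × b ^ t * eval p (k * t) < suc b ^ t
geometric-beats-polynomial b k p n₀ = t , n₀≤kt , decay
  where
  open ≤-Reasoning
  D = 2 ^ length p
  c = 2 * D * b
  x = k * c
  j = eval p x + n₀
  E = 2 ^ j
  t = c * E
  instance
    D≢0 : NonZero D
    D≢0 = m^n≢0 2 (length p)
    c≢0 : NonZero c
    c≢0 = m*n≢0 (2 * D) b {{m*n≢0 2 D}}
  kt≡Ex : k * t ≡ E * x
  kt≡Ex = regroup k c E
    where
    regroup : ∀ k c E → k * (c * E) ≡ E * (k * c)
    regroup = solve-∀
  n₀≤kt : n₀ ≤ k * t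
  n₀≤kt = begin
    n₀      ≤⟨ m≤n+m n₀ (eval p x) ⟩
    j       ≤⟨ <⇒≤ (n<2^n j) ⟩
    E       ≤⟨ m≤m*n E x {{m*n≢0 k c}} ⟩
    E * x   ≡⟨ kt≡Ex ⟨
    k * t   ∎
  b^c*2D≤[1+b]^c : b ^ c * (2 * D) ≤ suc b ^ c
  b^c*2D≤[1+b]^c = *-cancelʳ-≤ (b ^ c * (2 * D)) (suc b ^ c) b (begin
    b ^ c * (2 * D) * b       ≡⟨ *-assoc (b ^ c) (2 * D) b ⟩
    b ^ c * c                 ≤⟨ *-monoʳ-≤ (b ^ c) (m≤n+m c b) ⟩
    b ^ c * (b + c)           ≤⟨ bernoulli b c ⟩
    suc b ^ c * b             ∎)
  decay : b ^ t * eval p (k * t) < suc b ^ t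
  decay = begin-strict
    b ^ t * eval p (k * t)       ≡⟨ cong₂ _*_ (^-*-assoc b c E) (cong (eval p) (sym kt≡Ex)) ⟨
    (b ^ c) ^ E * eval p (E * x) <⟨ poly-at-2^j (b ^ c) {{m^n≢0 b c}} p x j (m≤m+n (eval p x) n₀) ⟩
    (b ^ c * (2 * D)) ^ E        ≤⟨ ^-monoˡ-≤ E b^c*2D≤[1+b]^c ⟩
    (suc b ^ c) ^ E              ≡⟨ ^-*-assoc (suc b) c E ⟩
    suc b ^ t                    ∎

-- Counting the words accepted by an advice automaton

zip-++ : ∀ {A B : Set} (x u : List A) (y v : List B) → length x ≡ length y →
  zip (x ++ u) (y ++ v) ≡ zip x y ++ zip u v
zip-++ []      u []      v _ = refl
zip-++ (a ∷ x) u (b ∷ y) v e = cong ((a , b) ∷_) (zip-++ x u y v (suc-injective e))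

split-length : ∀ {A : Set} k ℓ (a : List A) → length a ≡ k + ℓ →
  Σ (List A) λ a₁ → Σ (List A) λ a₂ → a ≡ a₁ ++ a₂ × length a₁ ≡ k × length a₂ ≡ ℓ
split-length zero    ℓ a       e = [] , a , refl , refl , e
split-length (suc k) ℓ (x ∷ a) e with split-length k ℓ a (suc-injective e)
... | a₁ , a₂ , refl , |a₁| , |a₂| = x ∷ a₁ , a₂ , refl , cong suc |a₁| , |a₂|

staircase : ℕ → ℕ → List Bool
staircase k j = replicate j true ++ replicate (k ∸ j) false

ones-staircase : ∀ k j → ones (staircase k j) ≡ j
ones-staircase k j = trans (ones-++ (replicate j true) _) (trans (cong₂ _+_ (ones-trues j) (ones-falses (k ∸ j))) (+-identityʳ j))
  where
  ones-trues : ∀ j → ones (replicate j true) ≡ j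
  ones-trues zero    = refl
  ones-trues (suc j) = cong suc (ones-trues j)
  ones-falses : ∀ n → ones (replicate n false) ≡ 0
  ones-falses zero    = refl
  ones-falses (suc n) = ones-falses n

length-staircase : ∀ {k j} → j ≤ k → length (staircase k j) ≡ k
length-staircase {k} {j} j≤k = begin
  length (staircase k j)                                        ≡⟨ length-++ (replicate j true) ⟩
  length (replicate j true) + length (replicate (k ∸ j) false)  ≡⟨ cong₂ _+_ (length-replicate j) (length-replicate (k ∸ j)) ⟩
  j + (k ∸ j)                                                   ≡⟨ m+[n∸m]≡n j≤k ⟩
  k                                                             ∎
  where open ≡-Reasoning

module Blocks {m : ℕ} (D : DFA (Bool × Fin m)) where
  open DFA D using (states; final)

  run-++ : ∀ q u v → run D q (u ++ v) ≡ run D (run D q u) v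
  run-++ q []      v = refl
  run-++ q (x ∷ u) v = run-++ (DFA.δ D q x) u v

  acceptsFrom : Fin states → List (Fin m) → List Bool → Bool
  acceptsFrom q a s = final (run D q (zip s a))

  #accepted : Fin states → List (Fin m) → ℕ
  #accepted q a = sumWords (length a) (indicator ∘ acceptsFrom q a)

  OnesDetermined : Fin states → List (Fin m) → Set
  OnesDetermined q a = ∀ s s' → length s ≡ length a → length s' ≡ length a →
    T (acceptsFrom q a s) → T (acceptsFrom q a s') → ones s ≡ ones s'

  acceptsFrom-++ : ∀ q a₁ a₂ u s → length u ≡ length a₁ →
    acceptsFrom q (a₁ ++ a₂) (u ++ s) ≡ acceptsFrom (run D q (zip u a₁)) a₂ s
  acceptsFrom-++ q a₁ a₂ u s |u| =
    cong final (trans (cong (run D q) (zip-++ u s a₁ a₂ |u|)) (run-++ q (zip u a₁) (zip s a₂)))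

  #accepted-++ : ∀ q a₁ a₂ → #accepted q (a₁ ++ a₂) ≡ sumWords (length a₁) (λ u → #accepted (run D q (zip u a₁)) a₂)
  #accepted-++ q a₁ a₂ = begin
    sumWords (length (a₁ ++ a₂)) (indicator ∘ acceptsFrom q (a₁ ++ a₂))
      ≡⟨ cong (λ n → sumWords n (indicator ∘ acceptsFrom q (a₁ ++ a₂))) (length-++ a₁) ⟩
    sumWords (length a₁ + length a₂) (indicator ∘ acceptsFrom q (a₁ ++ a₂))
      ≡⟨ sumWords-++ (length a₁) (length a₂) _ ⟩
    sumWords (length a₁) (λ u → sumWords (length a₂) (λ s → indicator (acceptsFrom q (a₁ ++ a₂) (u ++ s))))
      ≡⟨ sumWords-cong (length a₁) (λ u |u| → sumWords-cong (length a₂) (λ s _ → cong indicator (acceptsFrom-++ q a₁ a₂ u s |u|))) ⟩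
    sumWords (length a₁) (λ u → #accepted (run D q (zip u a₁)) a₂) ∎
    where open ≡-Reasoning

  OnesDetermined-suffix : ∀ q a₁ a₂ u → OnesDetermined q (a₁ ++ a₂) → length u ≡ length a₁ →
    OnesDetermined (run D q (zip u a₁)) a₂
  OnesDetermined-suffix q a₁ a₂ u det |u| s s' |s| |s'| acc acc' = +-cancelˡ-≡ (ones u) _ _ (begin
    ones u + ones s   ≡⟨ ones-++ u s ⟨
    ones (u ++ s)     ≡⟨ det (u ++ s) (u ++ s') (|u++| s |s|) (|u++| s' |s'|) (lift s acc) (lift s' acc') ⟩
    ones (u ++ s')    ≡⟨ ones-++ u s' ⟩
    ones u + ones s'  ∎)
    where
    open ≡-Reasoning
    |u++| : ∀ s → length s ≡ length a₂ → length (u ++ s) ≡ length (a₁ ++ a₂)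
    |u++| s |s| = trans (length-++ u) (trans (cong₂ _+_ |u| |s|) (sym (length-++ a₁)))
    lift : ∀ s → T (acceptsFrom (run D q (zip u a₁)) a₂ s) → T (acceptsFrom q (a₁ ++ a₂) (u ++ s))
    lift s = subst T (sym (acceptsFrom-++ q a₁ a₂ u s |u|))

  same-state⇒same-ones : ∀ q a₁ a₂ u u' → OnesDetermined q (a₁ ++ a₂) →
    length u ≡ length a₁ → length u' ≡ length a₁ →
    run D q (zip u a₁) ≡ run D q (zip u' a₁) → 0 < #accepted (run D q (zip u' a₁)) a₂ → ones u ≡ ones u'
  same-state⇒same-ones q a₁ a₂ u u' det |u| |u'| same live
    with s , |s| , acc ← sumWords-positive (length a₂) _ live =
    +-cancelʳ-≡ (ones s) _ _ (begin
      ones u + ones s    ≡⟨ ones-++ u s ⟨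
      ones (u ++ s)      ≡⟨ det (u ++ s) (u' ++ s) (|++| u |u|) (|++| u' |u'|) (lift u |u| accᵤ) (lift u' |u'| acc') ⟩
      ones (u' ++ s)     ≡⟨ ones-++ u' s ⟩
      ones u' + ones s   ∎)
    where
    open ≡-Reasoning
    acc' : T (acceptsFrom (run D q (zip u' a₁)) a₂ s)
    acc' = indicator-positive acc
    accᵤ : T (acceptsFrom (run D q (zip u a₁)) a₂ s)
    accᵤ = subst (λ r → T (acceptsFrom r a₂ s)) (sym same) acc'
    |++| : ∀ v → length v ≡ length a₁ → length (v ++ s) ≡ length (a₁ ++ a₂)
    |++| v |v| = trans (length-++ v) (trans (cong₂ _+_ |v| |s|) (sym (length-++ a₁)))
    lift : ∀ v → length v ≡ length a₁ → T (acceptsFrom (run D q (zip v a₁)) a₂ s) → T (acceptsFrom q (a₁ ++ a₂) (v ++ s))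
    lift v |v| = subst T (sym (acceptsFrom-++ q a₁ a₂ v s |v|))

  prefix : Fin (suc states) → List Bool
  prefix j = staircase states (toℕ j)

  length-prefix : ∀ j → length (prefix j) ≡ states
  length-prefix j = length-staircase (toℕ≤pred[n] j)

  dead-prefix : ∀ q a₁ a₂ → OnesDetermined q (a₁ ++ a₂) → length a₁ ≡ states →
    Σ (List Bool) λ u → length u ≡ length a₁ × #accepted (run D q (zip u a₁)) a₂ ≡ 0
  dead-prefix q a₁ a₂ det |a₁|
    with i , j , i<j , same ← pigeonhole (n<1+n states) (λ j → run D q (zip (prefix j) a₁))
    with #accepted (run D q (zip (prefix j) a₁)) a₂ in dead
  ... | zero  = prefix j , trans (length-prefix j) (sym |a₁|) , dead
  ... | suc _ = ⊥-elim (<-irrefl ones-eq i<j)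
    where
    open ≡-Reasoning
    |prefix| : ∀ j → length (prefix j) ≡ length a₁
    |prefix| j = trans (length-prefix j) (sym |a₁|)
    ones-eq : toℕ i ≡ toℕ j
    ones-eq = begin
      toℕ i            ≡⟨ ones-staircase states (toℕ i) ⟨
      ones (prefix i)  ≡⟨ same-state⇒same-ones q a₁ a₂ (prefix i) (prefix j) det (|prefix| i) (|prefix| j) same
                            (subst (0 <_) (sym dead) (s≤s z≤n)) ⟩
      ones (prefix j)  ≡⟨ ones-staircase states (toℕ j) ⟩
      toℕ j            ∎

  #accepted-≤ : ∀ t q a → OnesDetermined q a → length a ≡ states * t → #accepted q a ≤ (2 ^ states ∸ 1) ^ t
  #accepted-≤ zero    q []      _   _   = indicator≤1 (acceptsFrom q [] [])
  #accepted-≤ zero    q (_ ∷ _) _   |a| with () ← trans |a| (*-zeroʳ states)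
  #accepted-≤ (suc t) q a       det |a|
    with a₁ , a₂ , refl , |a₁| , |a₂| ← split-length states (states * t) a (trans |a| (*-suc states t))
    with u , |u| , dead ← dead-prefix q a₁ a₂ det |a₁| = begin
      #accepted q (a₁ ++ a₂)                                          ≡⟨ #accepted-++ q a₁ a₂ ⟩
      sumWords (length a₁) (λ v → #accepted (run D q (zip v a₁)) a₂)   ≤⟨ sumWords-≤-vanishing (length a₁) B suffix-≤ u |u| dead ⟩
      (2 ^ length a₁ ∸ 1) * B                                        ≡⟨ cong (λ k → (2 ^ k ∸ 1) * B) |a₁| ⟩
      (2 ^ states ∸ 1) ^ suc t                                       ∎
    where
    open ≤-Reasoning
    B = (2 ^ states ∸ 1) ^ t
    suffix-≤ : ∀ v → length v ≡ length a₁ → #accepted (run D q (zip v a₁)) a₂ ≤ B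
    suffix-≤ v |v| = #accepted-≤ t _ a₂ (OnesDetermined-suffix q a₁ a₂ v det |v|) |a₂|

OnesByLength : Language → Set
OnesByLength A = ∀ x y → length x ≡ length y → T (A x) → T (A y) → ones x ≡ ones y

REG/n-count-≤ : ∀ {A m} {h : (n : ℕ) → Vec (Fin m) n} (D : DFA (Bool × Fin m)) →
  (∀ x → A x ≡ accepts D (zip x (toList (h (length x))))) → OnesByLength A →
  ∀ t → count A (DFA.states D * t) ≤ (2 ^ DFA.states D ∸ 1) ^ t
REG/n-count-≤ {A} {h = h} D A≡ byLength t = begin
  count A n                                 ≡⟨ count≡sumWords A n ⟩
  sumWords n (indicator ∘ A)                ≡⟨ sumWords-cong n (λ x |x| → cong indicator (A≡ₙ x |x|)) ⟩
  sumWords n (indicator ∘ acceptsFrom q₀ a) ≡⟨ cong (λ k → sumWords k (indicator ∘ acceptsFrom q₀ a)) (length-toList (h n)) ⟨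
  #accepted q₀ a                            ≤⟨ #accepted-≤ t q₀ a determined (length-toList (h n)) ⟩
  (2 ^ DFA.states D ∸ 1) ^ t                ∎
  where
  open ≤-Reasoning
  open Blocks D
  q₀ = DFA.start D
  n = DFA.states D * t
  a = toList (h n)
  A≡ₙ : ∀ x → length x ≡ n → A x ≡ acceptsFrom q₀ a x
  A≡ₙ x |x| = trans (A≡ x) (cong (λ k → accepts D (zip x (toList (h k)))) |x|)
  determined : OnesDetermined q₀ a
  determined s s' |s| |s'| acc acc' = byLength s s' (trans |s| (sym |s'|)) (lift s |s| acc) (lift s' |s'| acc')
    where
    lift : ∀ x → length x ≡ length a → T (acceptsFrom q₀ a x) → T (A x)
    lift x |x| = subst T (sym (A≡ₙ x (trans |x| (length-toList (h n)))))

0<2^k∸1 : ∀ k .{{_ : NonZero k}} → 0 < 2 ^ k ∸ 1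
0<2^k∸1 k = m<n⇒0<n∸m (^-monoʳ-< 2 (s≤s (s≤s z≤n)) (>-nonZero⁻¹ k))

sparse⇒¬pdense : ∀ {A} k .{{_ : NonZero k}} → (∀ t → count A (k * t) ≤ (2 ^ k ∸ 1) ^ t) → ¬ PDense A
sparse⇒¬pdense {A} k sparse (n₀ , p , _ , dense)
  with t , n₀≤kt , decay ← geometric-beats-polynomial (2 ^ k ∸ 1) k p n₀ {{>-nonZero (0<2^k∸1 k)}} =
  <-irrefl refl (begin-strict
    2 ^ (k * t)                              ≤⟨ dense (k * t) n₀≤kt ⟩
    count A (k * t) * eval p (k * t)         ≤⟨ *-monoˡ-≤ (eval p (k * t)) (sparse t) ⟩
    (2 ^ k ∸ 1) ^ t * eval p (k * t)         <⟨ decay ⟩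
    suc (2 ^ k ∸ 1) ^ t                      ≡⟨ cong (_^ t) (m+[n∸m]≡n {1} (m^n>0 2 k)) ⟩
    (2 ^ k) ^ t                              ≡⟨ ^-*-assoc 2 k t ⟩
    2 ^ (k * t)                              ∎)
  where open ≤-Reasoning

halfOnes-ones-by-length : OnesByLength halfOnes
halfOnes-ones-by-length x y |x|≡|y| x∈ y∈ = begin
  ones x               ≡⟨ ≡ᵇ⇒≡ (ones x) _ x∈ ⟩
  ⌈ length x /2⌉       ≡⟨ cong ⌈_/2⌉ |x|≡|y| ⟩
  ⌈ length y /2⌉       ≡⟨ ≡ᵇ⇒≡ (ones y) _ y∈ ⟨
  ones y               ∎
  where open ≡-Reasoning

halfOnes-immune : ¬ (Σ Language λ A → REG/n A × A ⊆ halfOnes × PDense A)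
halfOnes-immune (A , (_ , h , D , A≡) , A⊆halfOnes , A-pdense) =
  sparse⇒¬pdense (DFA.states D) {{nonZero (DFA.start D)}}
    (REG/n-count-≤ {h = h} D A≡ (λ x y e x∈ y∈ → halfOnes-ones-by-length x y e (A⊆halfOnes x x∈) (A⊆halfOnes y y∈)))
    A-pdense
  where
  nonZero : ∀ {n} → Fin n → NonZero n
  nonZero {suc _} _ = _

proposition7p4 : Σ Language (λ L → CFL L × PrimeImmune L × ¬ WeakPseudorandom L)
proposition7p4 = halfOnes , halfOnes-cfl , (halfOnes-pdense , halfOnes-immune) , halfOnes-not-pseudorandom
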